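{- Let $q,q'$ be positive integers with $q\equiv q'\equiv0\pmod4$. Then $-1$ is an adjacency eigenvalue of $C_q\bowtie C_{q'}$.
   Context: For even $q$, $C_q$ is regarded as a balanced bipartite graph with $V=(v_1,\dots,v_{q/2})$, $U=(u_1,\dots,u_{q/2})$ and edges $v_iu_i$ and $v_{i+1}u_i$ for all $i$ (indices modulo $q/2$). For balanced bipartite graphs $G_1=(V_1\cup U_1,E_1)$, $G_2=(V_2\cup U_2,E_2)$ with orderings $V_i=(v^i_1,\dots,v^i_{n_i})$, $U_i=(u^i_1,\dots,u^i_{n_i})$, the balanced bipartite product $G_1\bowtie G_2$ has vertex set $V_1\times V_2\cup U_1\times U_2$ and edge set $\{(v^1_j,v^2)(u^1_j,u^2): j\in[n_1],\ v^2u^2\in E_2\}\cup\{(v^1,v^2_j)(u^1,u^2_j): j\in[n_2],\ v^1u^1\in E_1\}$. -}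

module Defs where

open import Data.Nat as ℕ using (ℕ; zero; suc; _+_; _*_; _/_)
open import Data.Bool using (Bool; true; false; _∧_; _∨_; if_then_else_)
open import Data.Fin as Fin using (Fin; toℕ; splitAt; remQuot)
open import Data.Fin.Properties using () renaming (_≟_ to _≟ᶠ_)
open import Data.Product using (_×_; _,_; Σ; ∃)
open import Data.Sum using (inj₁; inj₂)
open import Data.Rational using (ℚ; 0ℚ) renaming (_+_ to _+ℚ_; _*_ to _*ℚ_)
open import Relation.Nullary using (¬_)
open import Relation.Nullary.Decidable using (⌊_⌋)
open import Relation.Binary.PropositionalEquality using (_≡_)

-- A balanced bipartite graph with parts V = (v_0..v_{n-1}), U = (u_0..u_{n-1}),
-- given by its edge predicate: edge i j = true iff v_i u_j is an edge.
record BBG (n : ℕ) : Set where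
  field
    edge : Fin n → Fin n → Bool
open BBG public

-- C_q for even q, as a balanced bipartite graph on m = q/2 + q/2 vertices:
-- edges v_i u_i and v_{i+1} u_i (indices mod m, 0-based here).
cycleBBG : (m : ℕ) → BBG m
edge (cycleBBG m) a b =
  ⌊ toℕ a ℕ.≟ toℕ b ⌋ ∨ ⌊ toℕ a ℕ.≟ suc (toℕ b) ⌋
    ∨ (⌊ toℕ a ℕ.≟ 0 ⌋ ∧ ⌊ suc (toℕ b) ℕ.≟ m ⌋)

C : (q : ℕ) → BBG (q / 2)
C q = cycleBBG (q / 2)

-- Balanced bipartite product; the pair (x₁ , x₂) ∈ Fin n₁ × Fin n₂ is encoded
-- as the index combine x₁ x₂ ∈ Fin (n₁ * n₂) (decoded by remQuot).
_⋈_ : ∀ {n₁ n₂} → BBG n₁ → BBG n₂ → BBG (n₁ * n₂)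
edge (_⋈_ {n₁} {n₂} G₁ G₂) k l with remQuot n₂ k | remQuot n₂ l
... | (v₁ , v₂) | (u₁ , u₂) =
  (⌊ v₁ ≟ᶠ u₁ ⌋ ∧ edge G₂ v₂ u₂) ∨ (⌊ v₂ ≟ᶠ u₂ ⌋ ∧ edge G₁ v₁ u₁)

-- Adjacency relation (0/1 adjacency matrix) of the underlying graph on
-- vertex set Fin (n + n): first n indices are V, last n are U.
adj : ∀ {n} → BBG n → Fin (n + n) → Fin (n + n) → Bool
adj {n} G x y with splitAt n x | splitAt n y
... | inj₁ i | inj₂ j = edge G i j
... | inj₂ j | inj₁ i = edge G i j
... | _      | _      = false

sumℚ : ∀ {N} → (Fin N → ℚ) → ℚ
sumℚ {zero}  f = 0ℚ
sumℚ {suc N} f = f Fin.zero +ℚ sumℚ (λ i → f (Fin.suc i))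

-- λ is an eigenvalue of the 0/1 matrix A (over ℚ, equivalently over ℝ since
-- A is rational and λ rational): there is a nonzero x with A x = λ x.
IsEigenvalue : ∀ {N} → (Fin N → Fin N → Bool) → ℚ → Set
IsEigenvalue {N} A λ' =
  Σ (Fin N → ℚ) λ x →
    (∃ λ i → ¬ (x i ≡ 0ℚ)) ×
    (∀ i → sumℚ (λ j → if A i j then x j else 0ℚ) ≡ λ' *ℚ x i)

{-# OPTIONS --safe #-}
-- Write G · w for the biadjacency matrix B of G (rows V, columns U) applied to w.  If
-- G · w = Gᵀ · w = μ w with w ≠ 0, then (w, w) is a μ-eigenvector of the adjacency matrix.
-- In G₁ ⋈ G₂ the neighbours of (v_a, v_b) are the (u_a, u_d) with v_b u_d ∈ E₂ and the
-- (u_c, u_b) with v_a u_c ∈ E₁; if both factors contain the matching v_i u_i, these two sets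
-- meet exactly in (u_a, u_b).  So for s₁, s₂ annihilated by B and Bᵀ, inclusion–exclusion
-- gives ((G₁ ⋈ G₂) · (s₁ ⊗ s₂))(a, b) = 0 + 0 − s₁(a) s₂(b), and likewise for the transpose.
-- For C_q with 4 ∣ q each side has an even number q/2 of vertices, and the alternating
-- vector ((−1)^i)_i is annihilated: every vertex of C_q has two neighbours with consecutive
-- indices, also across the wrap-around since q/2 is even.
module Submission where

open import Defs
open import Data.Nat using (ℕ; _<_)
open import Data.Nat.Divisibility using (_∣_)
open import Data.Rational using (-_; 1ℚ)

open import Algebra.Bundles using (CommutativeRing)
open import Data.Bool using (Bool; true; false; T; _∧_; _∨_; if_then_else_)
open import Data.Bool.Properties using (∧-comm; ∧-zeroʳ; T-≡; ¬-not)
open import Data.Fin using (Fin; zero; suc; toℕ; splitAt; combine; quotient; remainder; _↑ˡ_; _↑ʳ_)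
open import Data.Fin.Properties using (_≟_)
import Data.Fin.Properties as Fin
open import Data.Nat as ℕ using (zero; suc)
import Data.Nat.Properties as ℕ
import Data.Nat.DivMod as ℕ
open import Data.Nat.Divisibility using (divides)
open import Data.Nat.Solver using (module +-*-Solver)
open +-*-Solver using (solve; _:+_; _:*_; _:=_; con)
open import Data.Rational using (ℚ; 0ℚ; _+_; _*_)
import Data.Rational.Properties as ℚ
open import Function using (_∘_)
open import Data.Empty using (⊥-elim)
open import Data.Product using (_×_; _,_; ∃; proj₁; proj₂; uncurry)
open import Data.Sum using (_⊎_; inj₁; inj₂; [_,_]′)
open import Function.Bundles using (_⇔_; mk⇔; Equivalence)
open import Function.Construct.Composition using (_⇔-∘_)
open import Relation.Nullary using (¬_; yes; no; contradiction)
open import Relation.Nullary.Decidable using (Dec; ⌊_⌋; isYes≗does; does-⇔)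
open import Relation.Binary.PropositionalEquality

open import Algebra.Properties.Group ℚ.+-0-group using (inverseˡ-unique; ⁻¹-involutive)
open import Algebra.Properties.Ring (CommutativeRing.ring ℚ.+-*-commutativeRing) using (-1*x≈-x)
open import Algebra.Properties.Semiring.Sum (CommutativeRing.semiring ℚ.+-*-commutativeRing)
  using (sum; sum-syntax; sum-cong-≗; sum-replicate-zero; ∑-distrib-+; *-distribˡ-sum; *-distribʳ-sum)

mask : Bool → ℚ → ℚ
mask b x = if b then x else 0ℚ

mask-∨ : ∀ A B x → mask (A ∨ B) x + mask (A ∧ B) x ≡ mask A x + mask B x
mask-∨ true  true  x = refl
mask-∨ true  false x = refl
mask-∨ false true  x = ℚ.+-comm x 0ℚ
mask-∨ false false x = refl

mask-∧ : ∀ A B x → mask (A ∧ B) x ≡ mask A (mask B x)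
mask-∧ true  B x = refl
mask-∧ false B x = refl

mask-∧-* : ∀ A B x y → mask (A ∧ B) (x * y) ≡ mask A x * mask B y
mask-∧-* true  true  x y = refl
mask-∧-* true  false x y = sym (ℚ.*-zeroʳ x)
mask-∧-* false B     x y = sym (ℚ.*-zeroˡ (mask B y))

sumℚ≡sum : ∀ {n} (f : Fin n → ℚ) → sumℚ f ≡ sum f
sumℚ≡sum {zero}  f = refl
sumℚ≡sum {suc n} f = cong (f zero +_) (sumℚ≡sum (f ∘ suc))

∑-↑ : ∀ m {n} (f : Fin (m ℕ.+ n) → ℚ) → sum f ≡ sum (f ∘ (_↑ˡ n)) + sum (f ∘ (m ↑ʳ_))
∑-↑ zero    f = sym (ℚ.+-identityˡ (sum f))
∑-↑ (suc m) f = trans (cong (f zero +_) (∑-↑ m (f ∘ suc))) (sym (ℚ.+-assoc (f zero) _ _))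

∑-combine : ∀ m {n} (f : Fin (m ℕ.* n) → ℚ) → sum f ≡ ∑[ i < m ] ∑[ j < n ] f (combine i j)
∑-combine zero    f = refl
∑-combine (suc m) {n} f =
  trans (∑-↑ n f) (cong (sum (f ∘ (_↑ˡ m ℕ.* n)) +_) (∑-combine m (f ∘ (n ↑ʳ_))))

∑-splitAt : ∀ m {n} (F : Fin m ⊎ Fin n → ℚ) →
            ∑[ j < m ℕ.+ n ] F (splitAt m j) ≡ ∑[ i < m ] F (inj₁ i) + ∑[ i < n ] F (inj₂ i)
∑-splitAt m {n} F = trans (∑-↑ m (F ∘ splitAt m)) (cong₂ _+_
  (sum-cong-≗ {m} λ i → cong F (Fin.splitAt-↑ˡ m i n))
  (sum-cong-≗ {n} λ i → cong F (Fin.splitAt-↑ʳ m n i)))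

⌊⌋-⇔ : ∀ {a b} {A : Set a} {B : Set b} → A ⇔ B → (a? : Dec A) (b? : Dec B) → ⌊ a? ⌋ ≡ ⌊ b? ⌋
⌊⌋-⇔ A⇔B a? b? = trans (isYes≗does a?) (trans (does-⇔ A⇔B a? b?) (sym (isYes≗does b?)))

∑-δ : ∀ {n} (i : Fin n) (f : Fin n → ℚ) → ∑[ j < n ] mask ⌊ i ≟ j ⌋ (f j) ≡ f i
∑-δ {suc n} zero    f = trans (cong (f zero +_) (sum-replicate-zero n)) (ℚ.+-identityʳ (f zero))
∑-δ         (suc i) f = trans (ℚ.+-identityˡ _) (trans (sum-cong-≗ λ j →
  cong (λ b → mask b (f (suc j))) (⌊⌋-⇔ (mk⇔ Fin.suc-injective (cong suc)) (suc i ≟ suc j) (i ≟ j)))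
  (∑-δ i (f ∘ suc)))

∑-δ-∧ : ∀ {n} (i : Fin n) (P : Fin n → Bool) (f : Fin n → ℚ) →
        ∑[ j < n ] mask (⌊ i ≟ j ⌋ ∧ P j) (f j) ≡ mask (P i) (f i)
∑-δ-∧ {n} i P f =
  trans (sum-cong-≗ {n} λ j → mask-∧ ⌊ i ≟ j ⌋ (P j) (f j)) (∑-δ i (λ j → mask (P j) (f j)))

∑-δ-toℕ : ∀ {n} p → p < n → (x : ℚ) → ∑[ j < n ] mask ⌊ p ℕ.≟ toℕ j ⌋ x ≡ x
∑-δ-toℕ {suc n} zero    _           x = trans (cong (x +_) (sum-replicate-zero n)) (ℚ.+-identityʳ x)
∑-δ-toℕ {suc n} (suc p) (ℕ.s≤s p<n) x = trans (ℚ.+-identityˡ _) (trans (sum-cong-≗ {n} λ j →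
  cong (λ b → mask b x) (⌊⌋-⇔ (mk⇔ ℕ.suc-injective (cong ℕ.suc)) (suc p ℕ.≟ suc (toℕ j)) (p ℕ.≟ toℕ j)))
  (∑-δ-toℕ p p<n x))

∑-mask-pair : ∀ {n} (P : ℕ → Bool) (g : ℕ → ℚ) {p q} → p < n → q < n → p ≢ q →
              (∀ {r} → r < n → T (P r) ⇔ (r ≡ p ⊎ r ≡ q)) →
              ∑[ j < n ] mask (P (toℕ j)) (g (toℕ j)) ≡ g p + g q
∑-mask-pair {n} P g {p} {q} p<n q<n p≢q P⇔ = begin
  ∑[ j < n ] mask (P (toℕ j)) (g (toℕ j))
    ≡⟨ sum-cong-≗ {n} (λ j → split (Fin.toℕ<n j)) ⟩
  ∑[ j < n ] (mask ⌊ p ℕ.≟ toℕ j ⌋ (g p) + mask ⌊ q ℕ.≟ toℕ j ⌋ (g q))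
    ≡⟨ ∑-distrib-+ {n} (λ j → mask ⌊ p ℕ.≟ toℕ j ⌋ (g p)) (λ j → mask ⌊ q ℕ.≟ toℕ j ⌋ (g q)) ⟩
  ∑[ j < n ] mask ⌊ p ℕ.≟ toℕ j ⌋ (g p) + ∑[ j < n ] mask ⌊ q ℕ.≟ toℕ j ⌋ (g q)
    ≡⟨ cong₂ _+_ (∑-δ-toℕ p p<n (g p)) (∑-δ-toℕ q q<n (g q)) ⟩
  g p + g q ∎
  where
  open ≡-Reasoning
  open Equivalence
  P-true : ∀ {r} → r < n → r ≡ p ⊎ r ≡ q → P r ≡ true
  P-true r<n r≡ = to T-≡ (from (P⇔ r<n) r≡)
  split : ∀ {r} → r < n → mask (P r) (g r) ≡ mask ⌊ p ℕ.≟ r ⌋ (g p) + mask ⌊ q ℕ.≟ r ⌋ (g q)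
  split {r} r<n with p ℕ.≟ r | q ℕ.≟ r
  ... | yes p≡r | yes q≡r = contradiction (trans p≡r (sym q≡r)) p≢q
  ... | yes refl | no _ =
    trans (cong (λ b → mask b (g p)) (P-true r<n (inj₁ refl))) (sym (ℚ.+-identityʳ (g p)))
  ... | no _ | yes refl =
    trans (cong (λ b → mask b (g q)) (P-true r<n (inj₂ refl))) (sym (ℚ.+-identityˡ (g q)))
  ... | no p≢r | no q≢r =
    cong (λ b → mask b (g r)) (¬-not λ Pr → [ p≢r ∘ sym , q≢r ∘ sym ]′ (to (P⇔ r<n) (from T-≡ Pr)))

∑-*-∑ : ∀ {m n} (u : Fin m → ℚ) (v : Fin n → ℚ) → ∑[ i < m ] ∑[ j < n ] (u i * v j) ≡ sum u * sum v
∑-*-∑ u v = trans (sum-cong-≗ (λ i → sym (*-distribˡ-sum (u i) v))) (sym (*-distribʳ-sum (sum v) u))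

∑-mask-⊗ : ∀ {m n} (B : Fin m → Fin n → Bool) (X : Fin m → Bool) (Y : Fin n → Bool)
           (u : Fin m → ℚ) (v : Fin n → ℚ) → (∀ i j → B i j ≡ X i ∧ Y j) →
           ∑[ i < m ] ∑[ j < n ] mask (B i j) (u i * v j)
             ≡ ∑[ i < m ] mask (X i) (u i) * ∑[ j < n ] mask (Y j) (v j)
∑-mask-⊗ {m} {n} B X Y u v B≡X∧Y = trans
  (sum-cong-≗ {m} λ i → sum-cong-≗ {n} λ j →
    trans (cong (λ b → mask b (u i * v j)) (B≡X∧Y i j)) (mask-∧-* (X i) (Y j) (u i) (v j)))
  (∑-*-∑ (λ i → mask (X i) (u i)) (λ j → mask (Y j) (v j)))

∑-mask-∨ : ∀ {n} (X Y : Fin n → Bool) (f : Fin n → ℚ) →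
           ∑[ j < n ] mask (X j ∨ Y j) (f j) + ∑[ j < n ] mask (X j ∧ Y j) (f j)
           ≡ ∑[ j < n ] mask (X j) (f j) + ∑[ j < n ] mask (Y j) (f j)
∑-mask-∨ {n} X Y f = trans
  (sym (∑-distrib-+ {n} (λ j → mask (X j ∨ Y j) (f j)) (λ j → mask (X j ∧ Y j) (f j))))
  (trans (sum-cong-≗ {n} λ j → mask-∨ (X j) (Y j) (f j))
         (∑-distrib-+ {n} (λ j → mask (X j) (f j)) (λ j → mask (Y j) (f j))))

∑∑-mask-∨ : ∀ {m n} (X Y : Fin m → Fin n → Bool) (f : Fin m → Fin n → ℚ) →
            ∑[ i < m ] ∑[ j < n ] mask (X i j ∨ Y i j) (f i j)
              + ∑[ i < m ] ∑[ j < n ] mask (X i j ∧ Y i j) (f i j)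
            ≡ ∑[ i < m ] ∑[ j < n ] mask (X i j) (f i j)
              + ∑[ i < m ] ∑[ j < n ] mask (Y i j) (f i j)
∑∑-mask-∨ {m} {n} X Y f = trans
  (sym (∑-distrib-+ {m} (λ i → ∑[ j < n ] mask (X i j ∨ Y i j) (f i j))
                        (λ i → ∑[ j < n ] mask (X i j ∧ Y i j) (f i j))))
  (trans (sum-cong-≗ {m} λ i → ∑-mask-∨ (X i) (Y i) (f i))
         (∑-distrib-+ {m} (λ i → ∑[ j < n ] mask (X i j) (f i j))
                          (λ i → ∑[ j < n ] mask (Y i j) (f i j))))

infixl 7 _·_
infix 30 _ᵀ

_·_ : ∀ {n} → BBG n → (Fin n → ℚ) → Fin n → ℚ
(G · w) i = ∑[ j < _ ] mask (edge G i j) (w j)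

_ᵀ : ∀ {n} → BBG n → BBG n
edge (G ᵀ) i j = edge G j i

InKernel : ∀ {n} → BBG n → (Fin n → ℚ) → Set
InKernel G w = ∀ i → (G · w) i ≡ 0ℚ

HasDiagonal : ∀ {n} → BBG n → Set
HasDiagonal G = ∀ i → edge G i i ≡ true

·-cong : ∀ {n} {G H : BBG n} → (∀ i j → edge G i j ≡ edge H i j) → ∀ w i → (G · w) i ≡ (H · w) i
·-cong {n} G≡H w i = sum-cong-≗ {n} λ j → cong (λ b → mask b (w j)) (G≡H i j)

bipartiteAdj : ∀ {n} → BBG n → Fin n ⊎ Fin n → Fin n ⊎ Fin n → Bool
bipartiteAdj G (inj₁ i) (inj₂ j) = edge G i j
bipartiteAdj G (inj₂ j) (inj₁ i) = edge G i j
bipartiteAdj G _        _        = false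

adj-splitAt : ∀ {n} (G : BBG n) x y → adj G x y ≡ bipartiteAdj G (splitAt n x) (splitAt n y)
adj-splitAt {n} G x y with splitAt n x | splitAt n y
... | inj₁ _ | inj₁ _ = refl
... | inj₁ _ | inj₂ _ = refl
... | inj₂ _ | inj₁ _ = refl
... | inj₂ _ | inj₂ _ = refl

isEigenvalue-adj : ∀ {n} (G : BBG n) (w : Fin n → ℚ) (μ : ℚ) → (∃ λ i → ¬ (w i ≡ 0ℚ)) →
                   (∀ i → (G · w) i ≡ μ * w i) → (∀ i → (G ᵀ · w) i ≡ μ * w i) →
                   IsEigenvalue (adj G) μ
isEigenvalue-adj {n} G w μ (i , wi≢0) Gw≡μw Gᵀw≡μw = x , (i ↑ˡ n , x≢0) , eigen
  where
  open ≡-Reasoning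
  x : Fin (n ℕ.+ n) → ℚ
  x = [ w , w ]′ ∘ splitAt n
  x≢0 : ¬ (x (i ↑ˡ n) ≡ 0ℚ)
  x≢0 rewrite Fin.splitAt-↑ˡ n i n = wi≢0
  blockSum : ∀ σ → ∑[ j < n ] mask (bipartiteAdj G σ (inj₁ j)) (w j)
               + ∑[ j < n ] mask (bipartiteAdj G σ (inj₂ j)) (w j) ≡ μ * [ w , w ]′ σ
  blockSum (inj₁ a) =
    trans (cong (_+ (G · w) a) (sum-replicate-zero n)) (trans (ℚ.+-identityˡ _) (Gw≡μw a))
  blockSum (inj₂ b) =
    trans (cong ((G ᵀ · w) b +_) (sum-replicate-zero n)) (trans (ℚ.+-identityʳ _) (Gᵀw≡μw b))
  eigen : ∀ k → sumℚ (λ j → if adj G k j then x j else 0ℚ) ≡ μ * x k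
  eigen k = begin
    sumℚ (λ j → mask (adj G k j) (x j))
      ≡⟨ sumℚ≡sum (λ j → mask (adj G k j) (x j)) ⟩
    ∑[ j < n ℕ.+ n ] mask (adj G k j) (x j)
      ≡⟨ sum-cong-≗ {n ℕ.+ n} (λ j → cong (λ b → mask b (x j)) (adj-splitAt G k j)) ⟩
    ∑[ j < n ℕ.+ n ] mask (bipartiteAdj G (splitAt n k) (splitAt n j)) (x j)
      ≡⟨ ∑-splitAt n (λ σ → mask (bipartiteAdj G (splitAt n k) σ) ([ w , w ]′ σ)) ⟩
    _ ≡⟨ blockSum (splitAt n k) ⟩
    μ * x k ∎

_⊗_ : ∀ {m n} → (Fin m → ℚ) → (Fin n → ℚ) → Fin (m ℕ.* n) → ℚ
(_⊗_ {m} {n} u v) k = u (quotient {m} n k) * v (remainder {m} n k)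

⊗-combine : ∀ {m n} (u : Fin m → ℚ) (v : Fin n → ℚ) i j → (u ⊗ v) (combine i j) ≡ u i * v j
⊗-combine u v i j = cong (uncurry λ i′ j′ → u i′ * v j′) (Fin.remQuot-combine i j)

⋈-edge-combine : ∀ {m₁ m₂} (G₁ : BBG m₁) (G₂ : BBG m₂) a b c d →
  edge (G₁ ⋈ G₂) (combine a b) (combine c d) ≡ (⌊ a ≟ c ⌋ ∧ edge G₂ b d) ∨ (⌊ b ≟ d ⌋ ∧ edge G₁ a c)
⋈-edge-combine {m₁} {m₂} G₁ G₂ a b c d =
  cong₂ productEdge (Fin.remQuot-combine a b) (Fin.remQuot-combine c d)
  where
  productEdge : Fin m₁ × Fin m₂ → Fin m₁ × Fin m₂ → Bool
  productEdge (v₁ , v₂) (u₁ , u₂) = (⌊ v₁ ≟ u₁ ⌋ ∧ edge G₂ v₂ u₂) ∨ (⌊ v₂ ≟ u₂ ⌋ ∧ edge G₁ v₁ u₁)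

⋈-ᵀ : ∀ {m₁ m₂} (G₁ : BBG m₁) (G₂ : BBG m₂) k l → edge ((G₁ ⋈ G₂) ᵀ) k l ≡ edge (G₁ ᵀ ⋈ G₂ ᵀ) k l
⋈-ᵀ {m₁} {m₂} G₁ G₂ k l = cong₂ (λ x y → (x ∧ edge G₂ d b) ∨ (y ∧ edge G₁ c a))
  (⌊⌋-⇔ (mk⇔ sym sym) (c ≟ a) (a ≟ c)) (⌊⌋-⇔ (mk⇔ sym sym) (d ≟ b) (b ≟ d))
  where
  a c : Fin m₁
  a = quotient m₂ k
  c = quotient m₂ l
  b d : Fin m₂
  b = remainder {m₁} m₂ k
  d = remainder {m₁} m₂ l

∧-swap : ∀ A B C D → (A ∧ B) ∧ (C ∧ D) ≡ (A ∧ D) ∧ (C ∧ B)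
∧-swap false B C     D = refl
∧-swap true  B false D = trans (∧-zeroʳ B) (sym (∧-zeroʳ D))
∧-swap true  B true  D = ∧-comm B D

module _ {m₁ m₂} (G₁ : BBG m₁) (G₂ : BBG m₂) (s₁ : Fin m₁ → ℚ) (s₂ : Fin m₂ → ℚ)
         (diag₁ : HasDiagonal G₁) (diag₂ : HasDiagonal G₂)
         (ker₁ : InKernel G₁ s₁) (ker₂ : InKernel G₂ s₂) where

  ⋈-·-⊗-combine : ∀ a b → ((G₁ ⋈ G₂) · (s₁ ⊗ s₂)) (combine a b) ≡ - (s₁ a * s₂ b)
  ⋈-·-⊗-combine a b = inverseˡ-unique _ _ (begin
    ((G₁ ⋈ G₂) · (s₁ ⊗ s₂)) (combine a b) + s₁ a * s₂ b
      ≡⟨ cong₂ _+_ expand (sym XYpart) ⟩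
    ∑∑ (λ c d → X c d ∨ Y c d) + ∑∑ (λ c d → X c d ∧ Y c d)
      ≡⟨ ∑∑-mask-∨ X Y f ⟩
    ∑∑ X + ∑∑ Y
      ≡⟨ cong₂ _+_ Xpart Ypart ⟩
    0ℚ ∎)
    where
    open ≡-Reasoning
    X Y : Fin m₁ → Fin m₂ → Bool
    X c d = ⌊ a ≟ c ⌋ ∧ edge G₂ b d
    Y c d = ⌊ b ≟ d ⌋ ∧ edge G₁ a c
    f : Fin m₁ → Fin m₂ → ℚ
    f c d = s₁ c * s₂ d
    ∑∑ : (Fin m₁ → Fin m₂ → Bool) → ℚ
    ∑∑ B = ∑[ c < m₁ ] ∑[ d < m₂ ] mask (B c d) (f c d)
    expand : ((G₁ ⋈ G₂) · (s₁ ⊗ s₂)) (combine a b) ≡ ∑∑ (λ c d → X c d ∨ Y c d)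
    expand = trans (∑-combine m₁ _) (sum-cong-≗ {m₁} λ c → sum-cong-≗ {m₂} λ d →
      cong₂ mask (⋈-edge-combine G₁ G₂ a b c d) (⊗-combine s₁ s₂ c d))
    Xpart : ∑∑ X ≡ 0ℚ
    Xpart = begin
      ∑∑ X ≡⟨ ∑-mask-⊗ X (λ c → ⌊ a ≟ c ⌋) (edge G₂ b) s₁ s₂ (λ _ _ → refl) ⟩
      ∑[ c < m₁ ] mask ⌊ a ≟ c ⌋ (s₁ c) * (G₂ · s₂) b ≡⟨ cong₂ _*_ (∑-δ a s₁) (ker₂ b) ⟩
      s₁ a * 0ℚ ≡⟨ ℚ.*-zeroʳ (s₁ a) ⟩
      0ℚ ∎
    Ypart : ∑∑ Y ≡ 0ℚ
    Ypart = begin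
      ∑∑ Y ≡⟨ ∑-mask-⊗ Y (edge G₁ a) (λ d → ⌊ b ≟ d ⌋) s₁ s₂ (λ c d → ∧-comm ⌊ b ≟ d ⌋ (edge G₁ a c)) ⟩
      (G₁ · s₁) a * ∑[ d < m₂ ] mask ⌊ b ≟ d ⌋ (s₂ d) ≡⟨ cong₂ _*_ (ker₁ a) (∑-δ b s₂) ⟩
      0ℚ * s₂ b ≡⟨ ℚ.*-zeroˡ (s₂ b) ⟩
      0ℚ ∎
    XYpart : ∑∑ (λ c d → X c d ∧ Y c d) ≡ s₁ a * s₂ b
    XYpart = begin
      ∑∑ (λ c d → X c d ∧ Y c d)
        ≡⟨ ∑-mask-⊗ _ (λ c → ⌊ a ≟ c ⌋ ∧ edge G₁ a c) (λ d → ⌊ b ≟ d ⌋ ∧ edge G₂ b d) s₁ s₂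
             (λ c d → ∧-swap ⌊ a ≟ c ⌋ (edge G₂ b d) ⌊ b ≟ d ⌋ (edge G₁ a c)) ⟩
      ∑[ c < m₁ ] mask (⌊ a ≟ c ⌋ ∧ edge G₁ a c) (s₁ c)
        * ∑[ d < m₂ ] mask (⌊ b ≟ d ⌋ ∧ edge G₂ b d) (s₂ d)
        ≡⟨ cong₂ _*_ (∑-δ-∧ a (edge G₁ a) s₁) (∑-δ-∧ b (edge G₂ b) s₂) ⟩
      mask (edge G₁ a a) (s₁ a) * mask (edge G₂ b b) (s₂ b)
        ≡⟨ cong₂ (λ x y → mask x (s₁ a) * mask y (s₂ b)) (diag₁ a) (diag₂ b) ⟩
      s₁ a * s₂ b ∎

  ⋈-·-⊗ : ∀ k → ((G₁ ⋈ G₂) · (s₁ ⊗ s₂)) k ≡ - (s₁ ⊗ s₂) k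
  ⋈-·-⊗ k = subst (λ k → ((G₁ ⋈ G₂) · (s₁ ⊗ s₂)) k ≡ - (s₁ ⊗ s₂) k) (Fin.combine-remQuot {m₁} m₂ k)
    (trans (⋈-·-⊗-combine a b) (cong -_ (sym (⊗-combine s₁ s₂ a b))))
    where
    a : Fin m₁
    a = quotient m₂ k
    b : Fin m₂
    b = remainder {m₁} m₂ k

⋈-eigenvalue : ∀ {m₁ m₂} (G₁ : BBG m₁) (G₂ : BBG m₂) (s₁ : Fin m₁ → ℚ) (s₂ : Fin m₂ → ℚ) →
  HasDiagonal G₁ → HasDiagonal G₂ →
  InKernel G₁ s₁ → InKernel (G₁ ᵀ) s₁ → InKernel G₂ s₂ → InKernel (G₂ ᵀ) s₂ →
  ∀ i j → ¬ (s₁ i * s₂ j ≡ 0ℚ) → IsEigenvalue (adj (G₁ ⋈ G₂)) (- 1ℚ)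
⋈-eigenvalue G₁ G₂ s₁ s₂ diag₁ diag₂ ker₁ kerᵀ₁ ker₂ kerᵀ₂ i j s₁s₂≢0 =
  isEigenvalue-adj (G₁ ⋈ G₂) (s₁ ⊗ s₂) (- 1ℚ)
    (combine i j , λ w≡0 → s₁s₂≢0 (trans (sym (⊗-combine s₁ s₂ i j)) w≡0))
    (λ k → trans (⋈-·-⊗ G₁ G₂ s₁ s₂ diag₁ diag₂ ker₁ ker₂ k) (sym (-1*x≈-x _)))
    (λ k → trans (·-cong (⋈-ᵀ G₁ G₂) (s₁ ⊗ s₂) k)
                 (trans (⋈-·-⊗ (G₁ ᵀ) (G₂ ᵀ) s₁ s₂ diag₁ diag₂ kerᵀ₁ kerᵀ₂ k) (sym (-1*x≈-x _))))

alternating : ℕ → ℚ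
alternating zero    = 1ℚ
alternating (suc n) = - alternating n

alternating-even : ∀ k → alternating (k ℕ.+ k) ≡ 1ℚ
alternating-even zero    = refl
alternating-even (suc k) = begin
  alternating (suc (k ℕ.+ suc k)) ≡⟨ cong (alternating ∘ suc) (ℕ.+-suc k k) ⟩
  - - alternating (k ℕ.+ k)       ≡⟨ ⁻¹-involutive (alternating (k ℕ.+ k)) ⟩
  alternating (k ℕ.+ k)           ≡⟨ alternating-even k ⟩
  1ℚ                              ∎
  where open ≡-Reasoning

CycleAdj : ℕ → ℕ → ℕ → Set
CycleAdj m p r = p ≡ r ⊎ p ≡ suc r ⊎ (p ≡ 0 × suc r ≡ m)

-- edge (cycleBBG m) a b is definitionally cycleAdj m (toℕ a) (toℕ b).
cycleAdj : ℕ → ℕ → ℕ → Bool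
cycleAdj m p r = ⌊ p ℕ.≟ r ⌋ ∨ ⌊ p ℕ.≟ suc r ⌋ ∨ (⌊ p ℕ.≟ 0 ⌋ ∧ ⌊ suc r ℕ.≟ m ⌋)

T-cycleAdj : ∀ m p r → T (cycleAdj m p r) ⇔ CycleAdj m p r
T-cycleAdj m p r with p ℕ.≟ r | p ℕ.≟ suc r | p ℕ.≟ 0 | suc r ℕ.≟ m
... | yes p≡r | _          | _       | _         = mk⇔ (λ _ → inj₁ p≡r) _
... | no _    | yes p≡r+1  | _       | _         = mk⇔ (λ _ → inj₂ (inj₁ p≡r+1)) _
... | no _    | no _       | yes p≡0 | yes r+1≡m = mk⇔ (λ _ → inj₂ (inj₂ (p≡0 , r+1≡m))) _
... | no p≢r  | no p≢r+1   | yes _   | no r+1≢m  = mk⇔ (λ ()) [ p≢r , [ p≢r+1 , r+1≢m ∘ proj₂ ]′ ]′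
... | no p≢r  | no p≢r+1   | no p≢0  | _         = mk⇔ (λ ()) [ p≢r , [ p≢r+1 , p≢0 ∘ proj₁ ]′ ]′

cycleAdj-zeroˡ : ∀ {M r} → CycleAdj (suc M) 0 r ⇔ (r ≡ 0 ⊎ r ≡ M)
cycleAdj-zeroˡ = mk⇔
  (λ { (inj₁ 0≡r) → inj₁ (sym 0≡r)
     ; (inj₂ (inj₁ ()))
     ; (inj₂ (inj₂ (_ , r+1≡m))) → inj₂ (ℕ.suc-injective r+1≡m) })
  (λ { (inj₁ refl) → inj₁ refl ; (inj₂ refl) → inj₂ (inj₂ (refl , refl)) })

cycleAdj-sucˡ : ∀ {m p r} → CycleAdj m (suc p) r ⇔ (r ≡ suc p ⊎ r ≡ p)
cycleAdj-sucˡ = mk⇔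
  (λ { (inj₁ p+1≡r) → inj₁ (sym p+1≡r)
     ; (inj₂ (inj₁ p+1≡r+1)) → inj₂ (sym (ℕ.suc-injective p+1≡r+1))
     ; (inj₂ (inj₂ (() , _))) })
  (λ { (inj₁ refl) → inj₁ refl ; (inj₂ refl) → inj₂ (inj₁ refl) })

cycleAdj-lastʳ : ∀ {M r} → r < suc M → CycleAdj (suc M) r M ⇔ (r ≡ M ⊎ r ≡ 0)
cycleAdj-lastʳ r<m = mk⇔
  (λ { (inj₁ r≡M) → inj₁ r≡M
     ; (inj₂ (inj₁ r≡M+1)) → ⊥-elim (ℕ.<-irrefl r≡M+1 r<m)
     ; (inj₂ (inj₂ (r≡0 , _))) → inj₂ r≡0 })
  (λ { (inj₁ r≡M) → inj₁ r≡M ; (inj₂ r≡0) → inj₂ (inj₂ (r≡0 , refl)) })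

cycleAdj-innerʳ : ∀ {M q r} → q ≢ M → CycleAdj (suc M) r q ⇔ (r ≡ q ⊎ r ≡ suc q)
cycleAdj-innerʳ q≢M = mk⇔
  (λ { (inj₁ r≡q) → inj₁ r≡q
     ; (inj₂ (inj₁ r≡q+1)) → inj₂ r≡q+1
     ; (inj₂ (inj₂ (_ , q+1≡m))) → ⊥-elim (q≢M (ℕ.suc-injective q+1≡m)) })
  (λ { (inj₁ r≡q) → inj₁ r≡q ; (inj₂ r≡q+1) → inj₂ (inj₁ r≡q+1) })

cycle-hasDiagonal : ∀ m → HasDiagonal (cycleBBG m)
cycle-hasDiagonal m a = Equivalence.to T-≡ (Equivalence.from (T-cycleAdj m (toℕ a) (toℕ a)) (inj₁ refl))

module _ (k : ℕ) where
  open ≡-Reasoning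

  private
    M m : ℕ
    M = suc (k ℕ.+ k)
    m = suc M

  alternating-last : alternating M ≡ - 1ℚ
  alternating-last = cong -_ (alternating-even k)

  alternating-row : ∀ {p} → p < m → ∑[ r < m ] mask (cycleAdj m p (toℕ r)) (alternating (toℕ r)) ≡ 0ℚ
  alternating-row {zero} _ = begin
    _                  ≡⟨ ∑-mask-pair (cycleAdj m 0) alternating ℕ.z<s (ℕ.n<1+n M) (λ ())
                            (λ {r} _ → cycleAdj-zeroˡ ⇔-∘ T-cycleAdj m 0 r) ⟩
    1ℚ + alternating M ≡⟨ cong (1ℚ +_) alternating-last ⟩
    1ℚ + - 1ℚ          ≡⟨ ℚ.+-inverseʳ 1ℚ ⟩
    0ℚ                 ∎
  alternating-row {suc p} p+1<m = begin
    _                                 ≡⟨ ∑-mask-pair (cycleAdj m (suc p)) alternating p+1<m (ℕ.<⇒≤ p+1<m)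
                                           ℕ.1+n≢n (λ {r} _ → cycleAdj-sucˡ ⇔-∘ T-cycleAdj m (suc p) r) ⟩
    - alternating p + alternating p   ≡⟨ ℚ.+-inverseˡ (alternating p) ⟩
    0ℚ                                ∎

  alternating-column : ∀ {q} → q < m → ∑[ r < m ] mask (cycleAdj m (toℕ r) q) (alternating (toℕ r)) ≡ 0ℚ
  alternating-column {q} q<m with q ℕ.≟ M
  ... | yes refl = begin
    _                  ≡⟨ ∑-mask-pair (λ r → cycleAdj m r M) alternating q<m ℕ.z<s (λ ())
                            (λ {r} r<m → cycleAdj-lastʳ r<m ⇔-∘ T-cycleAdj m r M) ⟩
    alternating M + 1ℚ ≡⟨ cong (_+ 1ℚ) alternating-last ⟩
    - 1ℚ + 1ℚ          ≡⟨ ℚ.+-inverseˡ 1ℚ ⟩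
    0ℚ                 ∎
  ... | no q≢M = begin
    _                                 ≡⟨ ∑-mask-pair (λ r → cycleAdj m r q) alternating q<m
                                           (ℕ.s≤s (ℕ.≤∧≢⇒< (ℕ.≤-pred q<m) q≢M)) (ℕ.1+n≢n ∘ sym)
                                           (λ {r} _ → cycleAdj-innerʳ q≢M ⇔-∘ T-cycleAdj m r q) ⟩
    alternating q + - alternating q   ≡⟨ ℚ.+-inverseʳ (alternating q) ⟩
    0ℚ                                ∎

  alternating∈ker : InKernel (cycleBBG m) (alternating ∘ toℕ)
  alternating∈ker a = alternating-row (Fin.toℕ<n a)

  alternating∈kerᵀ : InKernel (cycleBBG m ᵀ) (alternating ∘ toℕ)
  alternating∈kerᵀ b = alternating-column (Fin.toℕ<n b)

cycle⋈cycle-eigenvalue : ∀ k k′ →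
  IsEigenvalue (adj (cycleBBG (suc (suc (k ℕ.+ k))) ⋈ cycleBBG (suc (suc (k′ ℕ.+ k′))))) (- 1ℚ)
cycle⋈cycle-eigenvalue k k′ =
  ⋈-eigenvalue (cycleBBG _) (cycleBBG _) (alternating ∘ toℕ) (alternating ∘ toℕ)
    (cycle-hasDiagonal _) (cycle-hasDiagonal _)
    (alternating∈ker k) (alternating∈kerᵀ k) (alternating∈ker k′) (alternating∈kerᵀ k′) zero zero (λ ())

half-of-4∣ : ∀ {q} → 0 < q → 4 ∣ q → ∃ λ k → q ℕ./ 2 ≡ suc (suc (k ℕ.+ k))
half-of-4∣ () (divides zero refl)
half-of-4∣ _  (divides (suc k) refl) =
  k , trans (cong (ℕ._/ 2) (4[k+1]≡[2k+2]2 k)) (ℕ.m*n/n≡m (suc (suc (k ℕ.+ k))) 2)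
  where
  4[k+1]≡[2k+2]2 : ∀ k → suc k ℕ.* 4 ≡ suc (suc (k ℕ.+ k)) ℕ.* 2
  4[k+1]≡[2k+2]2 = solve 1 (λ k → (con 1 :+ k) :* con 4 := (con 2 :+ (k :+ k)) :* con 2) refl

lemma4p6 : (q q′ : ℕ) → 0 < q → 0 < q′ → 4 ∣ q → 4 ∣ q′ →
    IsEigenvalue (adj (C q ⋈ C q′)) (- 1ℚ)
lemma4p6 q q′ 0<q 0<q′ 4∣q 4∣q′ with half-of-4∣ 0<q 4∣q | half-of-4∣ 0<q′ 4∣q′
... | k , q/2≡2k+2 | k′ , q′/2≡2k′+2 =
  subst₂ (λ m m′ → IsEigenvalue (adj (cycleBBG m ⋈ cycleBBG m′)) (- 1ℚ)) (sym q/2≡2k+2) (sym q′/2≡2k′+2)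
    (cycle⋈cycle-eigenvalue k k′)
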